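{- Let $n,k$ be integers with $k\ge1$, $n>2k$. In every minimum vertex cover $c^*$ of the generalized Petersen graph $P(n,k)$, every strip has size at most $2k$ when $k$ is odd, and at most $2k+1$ when $k$ is even.
   Context: $P(n,k)$ has vertex set $U\cup V$, $U=\{u_1,\dots,u_n\}$, $V=\{v_1,\dots,v_n\}$, edges $u_iu_{i+1}$, $u_iv_i$, $v_iv_{i+k}$ (subscripts modulo $n$). For a vertex cover $c$ not containing all of $V$, a strip of $c$ is a maximal set of circularly consecutive vertices $\{v_i,v_{i+1},\dots,v_{i+m}\}$ of $V$ all belonging to $c$; its size is its number of vertices. -}

module Defs where

open import Data.Nat using (ℕ; zero; suc; _+_; _∸_; _%_; _≤_; _<_)
open import Data.Nat.DivMod using (m%n<n)
open import Data.Fin using (Fin; toℕ; fromℕ<)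
open import Data.Fin.Subset using (Subset; _∈_; _∉_; ∣_∣)
open import Data.Product using (_×_; Σ)
open import Data.Sum using (_⊎_)

_⊕_ : ∀ {n} → Fin n → ℕ → Fin n
_⊕_ {suc m} i j = fromℕ< (m%n<n (toℕ i + j) (suc m))

-- A vertex set of P(n,k): U-part and V-part, each a subset of Fin n
-- (u_i ↦ index i in the first, v_i ↦ index i in the second).
record VSet (n : ℕ) : Set where
  constructor ⟨_,_⟩
  field
    U : Subset n
    V : Subset n
open VSet public

size : ∀ {n} → VSet n → ℕ
size c = ∣ U c ∣ + ∣ V c ∣

-- vertex cover of P(n,k): edges u_i u_{i+1}, u_i v_i, v_i v_{i+k}
IsVertexCover : (n k : ℕ) → VSet n → Set
IsVertexCover n k c =
  (i : Fin n) →
    (i ∈ U c ⊎ (i ⊕ 1) ∈ U c) ×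
    (i ∈ U c ⊎ i ∈ V c) ×
    (i ∈ V c ⊎ (i ⊕ k) ∈ V c)

IsMinimumVertexCover : (n k : ℕ) → VSet n → Set
IsMinimumVertexCover n k c =
  IsVertexCover n k c × ((d : VSet n) → IsVertexCover n k d → size c ≤ size d)

-- A strip of c of size m starting at v_i: the vertices v_i, …, v_{i+m-1}
-- all lie in c, and it is maximal: v_{i-1} ∉ c and v_{i+m} ∉ c.
record IsStrip {n : ℕ} (c : VSet n) (i : Fin n) (m : ℕ) : Set where
  field
    nonempty : 1 ≤ m
    inside   : (j : ℕ) → j < m → (i ⊕ j) ∈ V c
    left     : (i ⊕ (n ∸ 1)) ∉ V c
    right    : (i ⊕ m) ∉ V c

module Submission where

-- Let c be a minimum vertex cover of P(n,k) and let S be a strip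
-- of c at v_i of size m.  Since v_{i-1} ∉ c, its spoke forces u_{i-1} ∈ c; we
-- measure positions from b = i-1, so v_{b+1}, …, v_{b+m} all lie in c.
-- Suppose some even P = 2h satisfies k < P and P + k ≤ m.
--   * Rim rerouting: while u_{b+2j} ∈ c and v_{b+2j+1} ∈ c, trading u_{b+2j+1}
--     for u_{b+2j+2} leaves a vertex cover that is no larger.  Repeating this
--     h times yields a cover, with the same V-part, containing u_{b+P}.
--   * In that cover v_{b+P} is redundant: its spoke is covered by u_{b+P} and
--     both inner neighbours v_{b+P±k} lie in the strip.  Removing it gives a
--     strictly smaller cover, contradicting minimality of c.
-- Taking P = 2(⌊k/2⌋+1), the least even number above k, we get P + k = 2k + 1
-- for odd k and 2k + 2 for even k, which gives the two bounds.

open import Defs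
open import Data.Nat using (ℕ; zero; suc; _+_; _*_; _∸_; _/_; _%_; _≤_; _<_; z≤n; s≤s)
open import Data.Nat.Properties
open import Data.Nat.DivMod using (m≡m%n+[m/n]*n; %-distribˡ-+; m%n%n≡m%n; [m+kn]%n≡m%n; m<n⇒m%n≡m; m%n<n)
open import Data.Nat.Tactic.RingSolver using (solve-∀)
open import Data.Fin using (Fin; toℕ)
open import Data.Fin.Properties using (toℕ-fromℕ<; toℕ-injective; toℕ<n) renaming (_≟_ to _≟ᶠ_)
open import Data.Fin.Subset using (Subset; _∈_; _∉_; ∣_∣; _∪_; _-_; ⁅_⁆; inside; outside)
open import Data.Fin.Subset.Properties using (_∈?_; x∈p∪q⁺; x∈p∧x≢y⇒x∈p-y; x∈⁅x⁆; x∈p⇒∣p-x∣<∣p∣; ∣⁅x⁆∣≡1)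
open import Data.Vec using (_∷_; [])
open import Data.Product using (_×_; ∃; Σ; _,_; proj₁)
open import Data.Sum using (_⊎_; inj₁; inj₂)
open import Data.Empty using (⊥; ⊥-elim)
open import Relation.Nullary using (yes; no)
open import Relation.Binary.PropositionalEquality

module Shift (n' : ℕ) where

  N : ℕ
  N = suc n'

  toℕ-⊕ : (x : Fin N) (j : ℕ) → toℕ (x ⊕ j) ≡ (toℕ x + j) % N
  toℕ-⊕ x j = toℕ-fromℕ< _

  ⊕-assoc : (x : Fin N) (a b : ℕ) → (x ⊕ a) ⊕ b ≡ x ⊕ (a + b)
  ⊕-assoc x a b = toℕ-injective (begin
      toℕ ((x ⊕ a) ⊕ b)                  ≡⟨ toℕ-⊕ (x ⊕ a) b ⟩
      (toℕ (x ⊕ a) + b) % N               ≡⟨ cong (λ t → (t + b) % N) (toℕ-⊕ x a) ⟩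
      ((toℕ x + a) % N + b) % N           ≡⟨ %-distribˡ-+ ((toℕ x + a) % N) b N ⟩
      ((toℕ x + a) % N % N + b % N) % N   ≡⟨ cong (λ t → (t + b % N) % N) (m%n%n≡m%n (toℕ x + a) N) ⟩
      ((toℕ x + a) % N + b % N) % N       ≡⟨ sym (%-distribˡ-+ (toℕ x + a) b N) ⟩
      (toℕ x + a + b) % N                 ≡⟨ cong (_% N) (+-assoc (toℕ x) a b) ⟩
      (toℕ x + (a + b)) % N               ≡⟨ sym (toℕ-⊕ x (a + b)) ⟩
      toℕ (x ⊕ (a + b))                   ∎)
    where open ≡-Reasoning

  ⊕-period : (x : Fin N) (j t : ℕ) → x ⊕ (j + t * N) ≡ x ⊕ j
  ⊕-period x j t = toℕ-injective (begin
      toℕ (x ⊕ (j + t * N))      ≡⟨ toℕ-⊕ x (j + t * N) ⟩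
      (toℕ x + (j + t * N)) % N  ≡⟨ cong (_% N) (sym (+-assoc (toℕ x) j (t * N))) ⟩
      (toℕ x + j + t * N) % N    ≡⟨ [m+kn]%n≡m%n (toℕ x + j) t N ⟩
      (toℕ x + j) % N            ≡⟨ sym (toℕ-⊕ x j) ⟩
      toℕ (x ⊕ j)                ∎)
    where open ≡-Reasoning

  ⊕-identityʳ : (x : Fin N) → x ⊕ 0 ≡ x
  ⊕-identityʳ x = toℕ-injective (begin
      toℕ (x ⊕ 0)      ≡⟨ toℕ-⊕ x 0 ⟩
      (toℕ x + 0) % N  ≡⟨ cong (_% N) (+-identityʳ (toℕ x)) ⟩
      toℕ x % N        ≡⟨ m<n⇒m%n≡m (toℕ<n x) ⟩
      toℕ x            ∎)
    where open ≡-Reasoning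

  ⊕-predecessor : (x : Fin N) (j : ℕ) → (x ⊕ n') ⊕ suc j ≡ x ⊕ j
  ⊕-predecessor x j = begin
      (x ⊕ n') ⊕ suc j   ≡⟨ ⊕-assoc x n' (suc j) ⟩
      x ⊕ (n' + suc j)   ≡⟨ cong (x ⊕_) (+-suc n' j) ⟩
      x ⊕ (N + j)        ≡⟨ cong (x ⊕_) (+-comm N j) ⟩
      x ⊕ (j + N)        ≡⟨ cong (λ t → x ⊕ (j + t)) (sym (*-identityˡ N)) ⟩
      x ⊕ (j + 1 * N)    ≡⟨ ⊕-period x j 1 ⟩
      x ⊕ j              ∎
    where open ≡-Reasoning

  ⊕-inverse : (x : Fin N) (j : ℕ) → (x ⊕ j) ⊕ (n' * j) ≡ x
  ⊕-inverse x j = begin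
      (x ⊕ j) ⊕ (n' * j)  ≡⟨ ⊕-assoc x j (n' * j) ⟩
      x ⊕ (N * j)         ≡⟨ cong (x ⊕_) (*-comm N j) ⟩
      x ⊕ (0 + j * N)     ≡⟨ ⊕-period x 0 j ⟩
      x ⊕ 0               ≡⟨ ⊕-identityʳ x ⟩
      x                   ∎
    where open ≡-Reasoning

  ⊕-cancelʳ : (x y : Fin N) (j : ℕ) → x ⊕ j ≡ y ⊕ j → x ≡ y
  ⊕-cancelʳ x y j e = begin
      x                   ≡⟨ sym (⊕-inverse x j) ⟩
      (x ⊕ j) ⊕ (n' * j)  ≡⟨ cong (_⊕ (n' * j)) e ⟩
      (y ⊕ j) ⊕ (n' * j)  ≡⟨ ⊕-inverse y j ⟩
      y                   ∎
    where open ≡-Reasoning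

  -- A shift by 0 < d < N moves every point: otherwise d would be a multiple of N.
  ⊕-no-fixpoint : (y : Fin N) {d : ℕ} → 0 < d → d < N → y ⊕ d ≢ y
  ⊕-no-fixpoint y {d} 0<d d<N fix = not-multiple ((toℕ y + d) / N) d≡qN
    where
      open ≡-Reasoning
      d≡qN : d ≡ (toℕ y + d) / N * N
      d≡qN = +-cancelˡ-≡ (toℕ y) d _ (begin
        toℕ y + d                                ≡⟨ m≡m%n+[m/n]*n (toℕ y + d) N ⟩
        (toℕ y + d) % N + (toℕ y + d) / N * N   ≡⟨ cong (_+ (toℕ y + d) / N * N) (trans (sym (toℕ-⊕ y d)) (cong toℕ fix)) ⟩
        toℕ y + (toℕ y + d) / N * N             ∎)
      not-multiple : (q : ℕ) → d ≢ q * N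
      not-multiple zero    e = <⇒≢ 0<d (sym e)
      not-multiple (suc q) e = <⇒≱ d<N (subst (N ≤_) (sym e) (m≤m+n N (q * N)))

∣p∪q∣≤∣p∣+∣q∣ : ∀ {n} (p q : Subset n) → ∣ p ∪ q ∣ ≤ ∣ p ∣ + ∣ q ∣
∣p∪q∣≤∣p∣+∣q∣ []            []            = z≤n
∣p∪q∣≤∣p∣+∣q∣ (outside ∷ p) (outside ∷ q) = ∣p∪q∣≤∣p∣+∣q∣ p q
∣p∪q∣≤∣p∣+∣q∣ (outside ∷ p) (inside ∷ q)  = subst (suc ∣ p ∪ q ∣ ≤_) (sym (+-suc ∣ p ∣ ∣ q ∣)) (s≤s (∣p∪q∣≤∣p∣+∣q∣ p q))
∣p∪q∣≤∣p∣+∣q∣ (inside ∷ p)  (outside ∷ q) = s≤s (∣p∪q∣≤∣p∣+∣q∣ p q)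
∣p∪q∣≤∣p∣+∣q∣ (inside ∷ p)  (inside ∷ q)  = s≤s (≤-trans (∣p∪q∣≤∣p∣+∣q∣ p q) (+-monoʳ-≤ ∣ p ∣ (n≤1+n ∣ q ∣)))

exchange-size : ∀ {n} {p : Subset n} {y : Fin n} (z : Fin n) → y ∈ p → ∣ (p - y) ∪ ⁅ z ⁆ ∣ ≤ ∣ p ∣
exchange-size {p = p} {y} z y∈p = begin
  ∣ (p - y) ∪ ⁅ z ⁆ ∣     ≤⟨ ∣p∪q∣≤∣p∣+∣q∣ (p - y) ⁅ z ⁆ ⟩
  ∣ p - y ∣ + ∣ ⁅ z ⁆ ∣   ≡⟨ cong (∣ p - y ∣ +_) (∣⁅x⁆∣≡1 z) ⟩
  ∣ p - y ∣ + 1           ≡⟨ +-comm ∣ p - y ∣ 1 ⟩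
  suc ∣ p - y ∣           ≤⟨ x∈p⇒∣p-x∣<∣p∣ y∈p ⟩
  ∣ p ∣                   ∎
  where open ≤-Reasoning

odd<double : ∀ {j h} → j < h → 2 * j + 1 < 2 * h
odd<double {j} {h} j<h = subst (_≤ 2 * h) (double-suc j) (*-monoʳ-≤ 2 j<h)
  where double-suc : ∀ j → 2 * suc j ≡ suc (2 * j + 1)
        double-suc = solve-∀

module Covers (n' k : ℕ) where
  open Shift n'

  RimReroute : VSet N → Fin N → Set
  RimReroute c y = Σ (Subset N) λ U' → IsVertexCover N k ⟨ U' , V c ⟩ × ∣ U' ∣ ≤ ∣ U c ∣ × y ∈ U'

  -- One rerouting step: if u_x and v_{x+1} are in the cover, then u_{x+2} can be
  -- brought in by trading it for u_{x+1}, whose three edges stay covered by u_x,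
  -- u_{x+2} and v_{x+1}.  If u_{x+1} is not in the cover, u_{x+2} already is.
  rerouteStep : 1 < N → (c : VSet N) → IsVertexCover N k c → {x : Fin N} →
                x ∈ U c → (x ⊕ 1) ∈ V c → RimReroute c (x ⊕ 2)
  rerouteStep 1<N c cover {x} x∈U y∈V with (x ⊕ 1) ∈? U c
  ... | no y∉U with cover (x ⊕ 1)
  ...   | inj₁ y∈U , _ = ⊥-elim (y∉U y∈U)
  ...   | inj₂ z∈U , _ = U c , cover , ≤-refl , subst (_∈ U c) (⊕-assoc x 1 1) z∈U
  rerouteStep 1<N c cover {x} x∈U y∈V | yes y∈U =
      U' , cover' , exchange-size z y∈U , subst (_∈ U') (⊕-assoc x 1 1) z∈U'
    where
      y z : Fin N
      y = x ⊕ 1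
      z = y ⊕ 1
      U' : Subset N
      U' = (U c - y) ∪ ⁅ z ⁆
      keep : ∀ {w} → w ∈ U c → w ≢ y → w ∈ U'
      keep w∈U w≢y = x∈p∪q⁺ (inj₁ (x∈p∧x≢y⇒x∈p-y w∈U w≢y))
      z∈U' : z ∈ U'
      z∈U' = x∈p∪q⁺ (inj₂ (x∈⁅x⁆ z))
      x∈U' : x ∈ U'
      x∈U' = keep x∈U (λ x≡y → ⊕-no-fixpoint x (s≤s z≤n) 1<N (sym x≡y))
      rim : (w : Fin N) → w ∈ U' ⊎ (w ⊕ 1) ∈ U'
      rim w with w ≟ᶠ y
      ... | yes refl = inj₂ z∈U'
      ... | no w≢y with cover w
      ...   | inj₁ w∈U , _ = inj₁ (keep w∈U w≢y)
      ...   | inj₂ w1∈U , _ with (w ⊕ 1) ≟ᶠ y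
      ...     | no w1≢y = inj₂ (keep w1∈U w1≢y)
      ...     | yes w1≡y = inj₁ (subst (_∈ U') (sym (⊕-cancelʳ w x 1 w1≡y)) x∈U')
      spoke : (w : Fin N) → w ∈ U' ⊎ w ∈ V c
      spoke w with w ≟ᶠ y
      ... | yes refl = inj₂ y∈V
      ... | no w≢y with cover w
      ...   | _ , inj₁ w∈U , _ = inj₁ (keep w∈U w≢y)
      ...   | _ , inj₂ w∈V , _ = inj₂ w∈V
      cover' : IsVertexCover N k ⟨ U' , V c ⟩
      cover' w with cover w
      ... | _ , _ , inner = rim w , spoke w , inner

  rerouteAlong : 1 < N → (c : VSet N) → IsVertexCover N k c → {b : Fin N} → b ∈ U c →
                 (h : ℕ) → ((j : ℕ) → j < h → (b ⊕ (2 * j + 1)) ∈ V c) →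
                 RimReroute c (b ⊕ (2 * h))
  rerouteAlong 1<N c cover {b} b∈U zero odd∈V =
    U c , cover , ≤-refl , subst (_∈ U c) (sym (⊕-identityʳ b)) b∈U
  rerouteAlong 1<N c cover {b} b∈U (suc h) odd∈V
    with rerouteAlong 1<N c cover b∈U h (λ j j<h → odd∈V j (m<n⇒m<1+n j<h))
  ... | U' , cover' , U'≤U , here∈U'
    with rerouteStep 1<N ⟨ U' , V c ⟩ cover' here∈U'
           (subst (_∈ V c) (sym (⊕-assoc b (2 * h) 1)) (odd∈V h (n<1+n h)))
  ...   | U'' , cover'' , U''≤U' , next∈U'' =
    U'' , cover'' , ≤-trans U''≤U' U'≤U , subst (_∈ U'') two-more next∈U''
    where
      two-more : (b ⊕ (2 * h)) ⊕ 2 ≡ b ⊕ (2 * suc h)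
      two-more = trans (⊕-assoc b (2 * h) 2) (cong (b ⊕_) (double-suc h))
        where double-suc : ∀ h → 2 * h + 2 ≡ 2 * suc h
              double-suc = solve-∀

  dropInner : (c : VSet N) → IsVertexCover N k c → {y : Fin N} → y ∈ U c →
              (y ⊕ k) ∈ V c → (y ⊕ k) ≢ y → ((x : Fin N) → x ⊕ k ≡ y → x ∈ V c) →
              IsVertexCover N k ⟨ U c , V c - y ⟩
  dropInner c cover {y} y∈U next∈V next≢y prev∈V w with cover w
  ... | rim , spoke , inner = rim , spoke' spoke , inner' inner
    where
      keep : ∀ {x} → x ∈ V c → x ≢ y → x ∈ V c - y
      keep = x∈p∧x≢y⇒x∈p-y
      spoke' : w ∈ U c ⊎ w ∈ V c → w ∈ U c ⊎ w ∈ V c - y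
      spoke' old with w ≟ᶠ y | old
      ... | yes refl | _        = inj₁ y∈U
      ... | no w≢y   | inj₁ w∈U = inj₁ w∈U
      ... | no w≢y   | inj₂ w∈V = inj₂ (keep w∈V w≢y)
      inner' : w ∈ V c ⊎ (w ⊕ k) ∈ V c → w ∈ V c - y ⊎ (w ⊕ k) ∈ V c - y
      inner' old with w ≟ᶠ y | old
      ... | yes refl | _         = inj₂ (keep next∈V next≢y)
      ... | no w≢y   | inj₁ w∈V  = inj₁ (keep w∈V w≢y)
      ... | no w≢y   | inj₂ wk∈V with (w ⊕ k) ≟ᶠ y
      ...   | no wk≢y  = inj₂ (keep wk∈V wk≢y)
      ...   | yes wk≡y = inj₁ (keep (prev∈V w wk≡y) w≢y)

  -- In a minimum cover, u_b together with v_{b+1}, …, v_{b+P+k}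
  -- is impossible when P = 2h is even and exceeds k: rerouting the rim brings
  -- u_{b+P} into the cover, and then v_{b+P} can be dropped by dropInner.
  noEvenWindow : 1 ≤ k → k < N → (c : VSet N) → IsMinimumVertexCover N k c →
                 {b : Fin N} → b ∈ U c → (h : ℕ) → k < 2 * h →
                 ((o : ℕ) → 1 ≤ o → o ≤ 2 * h + k → (b ⊕ o) ∈ V c) → ⊥
  noEvenWindow 1≤k k<N c (cover , minimal) {b} b∈U h k<P window
    with rerouteAlong (≤-trans (s≤s 1≤k) k<N) c cover b∈U h
           (λ j j<h → window (2 * j + 1) (m≤n+m 1 (2 * j)) (≤-trans (<⇒≤ (odd<double j<h)) (m≤m+n (2 * h) k)))
  ... | U' , cover' , U'≤U , y∈U' = <⇒≱ smaller (minimal ⟨ U' , V c - y ⟩ dropped)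
    where
      P : ℕ
      P = 2 * h
      y : Fin N
      y = b ⊕ P
      in-window : ∀ {o} → 1 ≤ o → o ≤ P + k → (b ⊕ o) ∈ V c
      in-window = window _
      1≤P : 1 ≤ P
      1≤P = ≤-trans (s≤s z≤n) (≤-trans (s≤s 1≤k) k<P)
      y∈V : y ∈ V c
      y∈V = in-window 1≤P (m≤m+n P k)
      next∈V : (y ⊕ k) ∈ V c
      next∈V = subst (_∈ V c) (sym (⊕-assoc b P k)) (in-window (≤-trans 1≤k (m≤n+m k P)) ≤-refl)
      prev∈V : (x : Fin N) → x ⊕ k ≡ y → x ∈ V c
      prev∈V x x+k≡y = subst (_∈ V c) (sym x≡prev)
                          (in-window (m<n⇒0<n∸m k<P) (≤-trans (m∸n≤m P k) (m≤m+n P k)))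
        where
          x≡prev : x ≡ b ⊕ (P ∸ k)
          x≡prev = ⊕-cancelʳ x (b ⊕ (P ∸ k)) k (begin
            x ⊕ k              ≡⟨ x+k≡y ⟩
            b ⊕ P              ≡⟨ cong (b ⊕_) (sym (m∸n+n≡m (<⇒≤ k<P))) ⟩
            b ⊕ (P ∸ k + k)    ≡⟨ sym (⊕-assoc b (P ∸ k) k) ⟩
            (b ⊕ (P ∸ k)) ⊕ k  ∎)
            where open ≡-Reasoning
      dropped : IsVertexCover N k ⟨ U' , V c - y ⟩
      dropped = dropInner ⟨ U' , V c ⟩ cover' y∈U' next∈V (⊕-no-fixpoint y 1≤k k<N) prev∈V
      smaller : size ⟨ U' , V c - y ⟩ < size c
      smaller = +-mono-≤-< U'≤U (x∈p⇒∣p-x∣<∣p∣ y∈V)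

  -- Read from its left end b = v_{i-1}, a strip at i of size m occupies positions
  -- 1, …, m, and u_b belongs to the cover because v_b does not.
  stripFromPredecessor : (c : VSet N) → IsVertexCover N k c → {i : Fin N} {m : ℕ} →
                         IsStrip c i m →
                         (i ⊕ n') ∈ U c × ((o : ℕ) → 1 ≤ o → o ≤ m → ((i ⊕ n') ⊕ o) ∈ V c)
  stripFromPredecessor c cover {i} {m} strip = b∈U , in-strip
    where
      b∈U : (i ⊕ n') ∈ U c
      b∈U with cover (i ⊕ n')
      ... | _ , inj₁ b∈U , _ = b∈U
      ... | _ , inj₂ b∈V , _ = ⊥-elim (IsStrip.left strip b∈V)
      in-strip : (o : ℕ) → 1 ≤ o → o ≤ m → ((i ⊕ n') ⊕ o) ∈ V c
      in-strip (suc j) _ j<m = subst (_∈ V c) (sym (⊕-predecessor i j)) (IsStrip.inside strip j j<m)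

module HalfUp (k : ℕ) where
  r : ℕ
  r = k / 2

  k≡parity+2r : k ≡ k % 2 + r * 2
  k≡parity+2r = m≡m%n+[m/n]*n k 2

  k<2[r+1] : k < 2 * suc r
  k<2[r+1] = begin-strict
    k                ≡⟨ k≡parity+2r ⟩
    k % 2 + r * 2    <⟨ +-monoˡ-< (r * 2) (m%n<n k 2) ⟩
    2 + r * 2        ≡⟨ twice-suc r ⟩
    2 * suc r        ∎
    where
      open ≤-Reasoning
      twice-suc : ∀ r → 2 + r * 2 ≡ 2 * suc r
      twice-suc = solve-∀

  odd-window : k % 2 ≡ 1 → 2 * suc r + k ≡ suc (2 * k)
  odd-window odd = from-shape k (trans k≡parity+2r (cong (_+ r * 2) odd))
    where
      from-shape : ∀ k → k ≡ 1 + r * 2 → 2 * suc r + k ≡ suc (2 * k)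
      from-shape _ refl = shape r
        where shape : ∀ r → 2 * suc r + (1 + r * 2) ≡ suc (2 * (1 + r * 2))
              shape = solve-∀

  even-window : k % 2 ≡ 0 → 2 * suc r + k ≡ suc (2 * k + 1)
  even-window even = from-shape k (trans k≡parity+2r (cong (_+ r * 2) even))
    where
      from-shape : ∀ k → k ≡ 0 + r * 2 → 2 * suc r + k ≡ suc (2 * k + 1)
      from-shape _ refl = shape r
        where shape : ∀ r → 2 * suc r + (0 + r * 2) ≡ suc (2 * (0 + r * 2) + 1)
              shape = solve-∀

proposition4 : (n k : ℕ) → 1 ≤ k → 2 * k < n →
    (c : VSet n) → IsMinimumVertexCover n k c →
    (∃ λ (i : Fin n) → i ∉ V c) →
    (i : Fin n) (m : ℕ) → IsStrip c i m →
      (k % 2 ≡ 1 → m ≤ 2 * k) × (k % 2 ≡ 0 → m ≤ 2 * k + 1)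
proposition4 zero    k _   ()
proposition4 (suc n') k 1≤k 2k<n c minimum _ i m strip =
    (λ odd  → ≮⇒≥ (λ 2k<m   → too-long (subst (_≤ m) (sym (odd-window odd)) 2k<m)))
  , (λ even → ≮⇒≥ (λ 2k+1<m → too-long (subst (_≤ m) (sym (even-window even)) 2k+1<m)))
  where
    open Covers n' k
    open HalfUp k
    k<n : k < suc n'
    k<n = ≤-trans (s≤s (m≤m+n k (k + 0))) 2k<n
    too-long : 2 * suc r + k ≤ m → ⊥
    too-long long with stripFromPredecessor c (proj₁ minimum) strip
    ... | b∈U , in-strip = noEvenWindow 1≤k k<n c minimum b∈U (suc r) k<2[r+1]
                             (λ o 1≤o o≤ → in-strip o 1≤o (≤-trans o≤ long))
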